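{- Let $p$ be a function on graphs of the form $p(G)=\sum_H c_H H(G)$, a finite complex linear combination over isomorphism types $H$. Then $p$ is 2-additive, i.e. $p(G_1\cup G_2)=p(G_1)+p(G_2)$ for every union of graphs $G_1,G_2$ having at most one vertex in common, if and only if $c_H=0$ for every $H$ that is not 2-connected.
   Context: All graphs are finite simple graphs; 2-connected graphs are assumed to have at least two vertices. $H(G)$ denotes the number of (not necessarily induced) subgraphs of $G$ isomorphic to $H$; these functions are linearly independent, so the $c_H$ are determined by $p$. -}

module Defs where

open import Level using (Level; _⊔_)
open import Data.Nat using (ℕ; zero; suc; _≤_)
open import Data.Fin using (Fin; _≟_)
open import Data.Bool using (Bool; true; false; _∧_; not; if_then_else_)
import Data.Bool.Properties as BoolP
open import Data.Vec using (Vec; []; _∷_; lookup; tabulate)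
import Data.Vec.Properties as VecP
open import Data.List using (List; []; _∷_; [_]; map; concatMap; allFin; filter; length; deduplicate; foldr)
open import Data.Bool.ListAction using (any; all)
open import Data.Unit using (⊤)
open import Data.Product using (Σ; _×_; _,_; ∃; ∃₂; proj₁; proj₂)
import Data.Product.Properties as ProdP
open import Data.Sum using (_⊎_)
open import Relation.Nullary using (¬_; does)
open import Relation.Binary.PropositionalEquality using (_≡_; _≢_)
open import Function.Bundles using (_↔_; Inverse; _⇔_)
open import Algebra.Bundles using (CommutativeRing)

record Graph (n : ℕ) : Set where
  field
    adj    : Fin n → Fin n → Bool
    sym    : ∀ i j → adj i j ≡ adj j i
    irrefl : ∀ i → adj i i ≡ false
open Graph public

record Iso {a b : ℕ} (G : Graph a) (H : Graph b) : Set where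
  field
    bij      : Fin a ↔ Fin b
    preserve : ∀ i j → adj H (Inverse.to bij i) (Inverse.to bij j) ≡ adj G i j

data Walk {n : ℕ} (G : Graph n) (ok : Fin n → Set) : Fin n → Fin n → Set where
  here : ∀ {u} → ok u → Walk G ok u u
  step : ∀ {u w v} → ok u → adj G u w ≡ true → Walk G ok w v → Walk G ok u v

Connected : ∀ {n} → Graph n → Set
Connected G = ∀ u v → Walk G (λ _ → ⊤) u v

TwoConnected : ∀ {n} → Graph n → Set
TwoConnected {n} G =
  2 ≤ n × Connected G ×
  (∀ x u v → u ≢ x → v ≢ x → Walk G (λ w → w ≢ x) u v)

-- H(G): number of (not necessarily induced) subgraphs of G isomorphic to H.
-- A subgraph isomorphic to H is exactly the image (vertex set, edge set)
-- of an injective homomorphism H → G; we count distinct such images.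

allVecs : (h n : ℕ) → List (Vec (Fin n) h)
allVecs zero    n = [ [] ]
allVecs (suc h) n = concatMap (λ x → map (x ∷_) (allVecs h n)) (allFin n)

_==_ : ∀ {n} → Fin n → Fin n → Bool
i == j = does (i ≟ j)

isInjective : ∀ {h n} → Vec (Fin n) h → Bool
isInjective {h} f =
  all (λ i → all (λ j → (i == j) Data.Bool.∨ not (lookup f i == lookup f j)) (allFin h)) (allFin h)
  where import Data.Bool

isHom : ∀ {h n} → Graph h → Graph n → Vec (Fin n) h → Bool
isHom {h} H G f =
  all (λ i → all (λ j → not (adj H i j) Data.Bool.∨ adj G (lookup f i) (lookup f j)) (allFin h)) (allFin h)
  where import Data.Bool

-- A subgraph of a graph on Fin n: vertex set and edge set (as Boolean data).
SubgraphData : ℕ → Set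
SubgraphData n = Vec Bool n × Vec (Vec Bool n) n

image : ∀ {h n} → Graph h → Vec (Fin n) h → SubgraphData n
image {h} H f =
  tabulate (λ v → any (λ i → lookup f i == v) (allFin h)) ,
  tabulate (λ v → tabulate (λ w →
    any (λ i → any (λ j → adj H i j ∧ (lookup f i == v) ∧ (lookup f j == w)) (allFin h)) (allFin h)))


copies : ∀ {h n} → Graph h → Graph n → ℕ
copies {h} {n} H G =
  length (deduplicate (ProdP.≡-dec (VecP.≡-dec BoolP._≟_) (VecP.≡-dec (VecP.≡-dec BoolP._≟_)))
    (map (image H)
      (filter (λ f → Data.Bool.Properties.T? (isInjective f ∧ isHom H G f)) (allVecs h n))))
  where import Data.Bool.Properties

-- G is the union of G₁ and G₂, which have at most one vertex in common.
-- G₁, G₂ are identified with subgraphs of G via injective maps e₁, e₂.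

record UnionAtMostOneCommon {n a b : ℕ} (G : Graph n) (G₁ : Graph a) (G₂ : Graph b) : Set where
  field
    e₁     : Fin a → Fin n
    e₂     : Fin b → Fin n
    inj₁   : ∀ i j → e₁ i ≡ e₁ j → i ≡ j
    inj₂   : ∀ i j → e₂ i ≡ e₂ j → i ≡ j
    cover  : ∀ x → (∃ λ i → e₁ i ≡ x) ⊎ (∃ λ j → e₂ j ≡ x)
    edges  : ∀ x y → (adj G x y ≡ true) ⇔
               ((∃₂ λ i j → e₁ i ≡ x × e₁ j ≡ y × adj G₁ i j ≡ true) ⊎
                (∃₂ λ i j → e₂ i ≡ x × e₂ j ≡ y × adj G₂ i j ≡ true))
    -- |V(G₁) ∩ V(G₂)| ≤ 1
    common : ∀ i j i′ j′ → e₁ i ≡ e₂ j → e₁ i′ ≡ e₂ j′ → i ≡ i′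

module Poly {c ℓ : Level} (R : CommutativeRing c ℓ) where
  open CommutativeRing R

  -- A term c_H · H : (number of vertices of H, H, c_H)
  Term : Set c
  Term = Σ ℕ (λ h → Graph h × Carrier)

  size : Term → ℕ
  size = proj₁

  graph : (t : Term) → Graph (size t)
  graph t = proj₁ (proj₂ t)

  coeff : Term → Carrier
  coeff t = proj₂ (proj₂ t)

  fromℕ : ℕ → Carrier
  fromℕ zero    = 0#
  fromℕ (suc k) = 1# + fromℕ k

  eval : List Term → ∀ {n} → Graph n → Carrier
  eval L G = foldr (λ t acc → coeff t * fromℕ (copies (graph t) G) + acc) 0# L

  TwoAdditive : List Term → Set ℓ
  TwoAdditive L = ∀ {n a b} (G : Graph n) (G₁ : Graph a) (G₂ : Graph b) →
    UnionAtMostOneCommon G G₁ G₂ → eval L G ≈ eval L G₁ + eval L G₂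

module Submission where

-- Both directions rest on two facts about the counts.
--   (A) If H is 2-connected and G = G₁ ∪ G₂ with at most one common vertex,
--       then H(G) = H(G₁) + H(G₂): a copy of H cannot pass through the single
--       shared vertex, so it lies in G₁ or in G₂, and not in both.
--   (B) If H is not 2-connected, then either H has at most one vertex and
--       H = H ∪ H, or H = G₁ ∪ G₂ for two induced subgraphs with fewer vertices
--       and at most one common vertex (found by a reachability computation).
-- (A) gives the backward direction termwise.  For the forward direction we
-- induct on the weight |V(H)| + |E(H)| of the graph H of a term: evaluating
-- 2-additivity on the union (B) makes every other term cancel (2-connected
-- terms by (A), smaller ones by induction, the others have no copies at all),
-- leaving c_H · H(H) = c_H · (H(G₁) + H(G₂)), i.e. c_H = 0 or c_H = 2 c_H.

open import Defs hiding (sym)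
open import Level using (Level)
open import Data.Nat as ℕ using (ℕ; zero; suc; _≤_; _<_; z≤n; s≤s)
open import Data.Nat.Properties
  using (+-mono-≤; +-mono-<-≤; +-cancelˡ-≡; m≤n⇒m<n∨m≡n; <-irrefl; ≤-antisym; ≤-trans; ≤-<-trans;
         <-≤-trans; _<?_; ≮⇒≥)
open import Data.Nat.Induction using (<-rec)
open import Data.Fin using (Fin; zero; suc; _≟_)
open import Data.Fin.Properties as Fin using (injective⇒≤)
open import Data.Bool using (Bool; true; false; T; _∧_; _∨_; not)
open import Data.Bool.Properties using (T-∧; T-∨; T-≡; T?) renaming (_≟_ to _≟ᵇ_)
open import Data.Bool.ListAction using (any; all)
open import Data.Unit using (tt)
open import Data.Empty using (⊥-elim)
open import Data.Vec as Vec using (Vec; []; _∷_; lookup; tabulate)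
open import Data.Vec.Properties as VecP
  using (lookup∘tabulate; tabulate-cong; lookup-map; tabulate-∘; tabulate∘lookup)
open import Data.List as List
  using (List; []; _∷_; _++_; map; filter; allFin; length; deduplicate; cartesianProduct)
open import Data.List.Properties using (length-++; length-map; length-tabulate)
open import Data.List.Relation.Unary.All as All using (All; []; _∷_)
open import Data.List.Relation.Unary.All.Properties using (all⁺; all⁻; ─⁺)
open import Data.List.Relation.Unary.AllPairs using (AllPairs; []; _∷_)
open import Data.List.Relation.Unary.Any using (here; there; index; _─_)
open import Data.List.Relation.Unary.Any.Properties using (lookup-index; any⁺; any⁻)
open import Data.List.Relation.Unary.Unique.Propositional using (Unique)
import Data.List.Relation.Unary.Unique.Propositional.Properties as Unique
open import Data.List.Relation.Unary.Unique.DecPropositional.Properties using (deduplicate-!)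
open import Data.List.Membership.Propositional using (_∈_; _∉_; lose; find)
open import Data.List.Membership.Propositional.Properties
  using (∈-lookup; ∈-deduplicate⁻; deduplicate-∈⇔; ∈-map⁺; ∈-map⁻; ∈-++⁺ˡ; ∈-++⁺ʳ; ∈-++⁻;
         ∈-allFin; ∈-concatMap⁺; ∈-filter⁺; ∈-filter⁻; ∈-cartesianProduct⁺)
open import Data.List.Membership.Propositional.Properties.WithK using (unique∧set⇒bag)
open import Data.List.Membership.DecPropositional using () renaming (_∈?_ to member?)
open import Data.List.Relation.Binary.BagAndSetEquality using (_∼[_]_; set; ∼bag⇒↭; ++-cong; ∷-cong)
open import Data.List.Relation.Binary.Permutation.Propositional.Properties using (↭-length)
open import Data.Product using (Σ; ∃; ∃₂; _×_; _,_; proj₁; proj₂)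
open import Data.Product.Properties as Product using (,-injective)
open import Data.Sum using (_⊎_; inj₁; inj₂)
import Data.Sum as Sum
open import Relation.Nullary using (¬_; Dec; yes; no; contradiction)
open import Relation.Nullary.Decidable using (_×-dec_; _→-dec_)
open import Relation.Binary.Definitions using (DecidableEquality)
open import Relation.Binary.PropositionalEquality
  using (_≡_; _≢_; refl; sym; trans; cong; cong₂; subst; subst₂; module ≡-Reasoning)
open import Function.Base using (_∘_; const)
open import Function.Bundles using (_⇔_; mk⇔; Equivalence; Inverse; mk↔ₛ′)
open Equivalence using (to; from)
import Function.Properties.Equivalence as ⇔
open import Algebra.Bundles using (CommutativeRing)

module _ {a} {A : Set a} where

  unique⇒lookup-injective : ∀ {xs : List A} → Unique xs →
    ∀ i j → List.lookup xs i ≡ List.lookup xs j → i ≡ j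
  unique⇒lookup-injective (_ ∷ _) zero zero _ = refl
  unique⇒lookup-injective (x∉ ∷ _) zero (suc j) e = contradiction e (All.lookup x∉ (∈-lookup j))
  unique⇒lookup-injective (x∉ ∷ _) (suc i) zero e = contradiction (sym e) (All.lookup x∉ (∈-lookup i))
  unique⇒lookup-injective (_ ∷ u) (suc i) (suc j) e = cong suc (unique⇒lookup-injective u i j e)

  -- A duplicate-free list contained in ys is at most as long as ys
  -- (its positions inject into those of ys).
  ⊆⇒length≤ : ∀ {xs ys : List A} → Unique xs → (∀ {z} → z ∈ xs → z ∈ ys) → length xs ≤ length ys
  ⊆⇒length≤ {xs} {ys} u sub = injective⇒≤ {f = position} λ {i} {j} e →
    unique⇒lookup-injective u i j (trans (lookup-index (sub (∈-lookup i)))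
      (trans (cong (List.lookup ys) e) (sym (lookup-index (sub (∈-lookup j))))))
    where
      position : _ → _
      position i = index (sub (∈-lookup {xs = xs} i))

  ⊂⇒length< : ∀ {xs ys : List A} {y} → Unique xs → (∀ {z} → z ∈ xs → z ∈ ys) →
    y ∈ ys → y ∉ xs → length xs < length ys
  ⊂⇒length< {xs} {ys} {y} u sub y∈ys y∉xs =
    ⊆⇒length≤ (All.tabulate (λ z∈xs y≡z → y∉xs (subst (_∈ xs) (sym y≡z) z∈xs)) ∷ u) sub′
    where
      sub′ : ∀ {z} → z ∈ y ∷ xs → z ∈ ys
      sub′ (here refl) = y∈ys
      sub′ (there z∈xs) = sub z∈xs

-- Counting the distinct entries of a list; `copies` is such a count.
-- Every statement reduces to `card-unique`: all duplicate-free lists with the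
-- same elements are permutations of each other.
module Card {a} {A : Set a} (_≟_ : DecidableEquality A) where

  card : List A → ℕ
  card xs = length (deduplicate _≟_ xs)

  dedup-set : (xs : List A) → xs ∼[ set ] deduplicate _≟_ xs
  dedup-set xs = deduplicate-∈⇔ _≟_ {xs}

  card-unique : ∀ {xs ys} → Unique xs → xs ∼[ set ] ys → length xs ≡ card ys
  card-unique {xs} {ys} u xs~ys =
    ↭-length (∼bag⇒↭ (unique∧set⇒bag u (deduplicate-! _≟_ ys) (⇔.trans xs~ys (dedup-set ys))))

  card-cong : ∀ {xs ys} → xs ∼[ set ] ys → card xs ≡ card ys
  card-cong {xs} xs~ys = card-unique (deduplicate-! _≟_ xs) (⇔.trans (⇔.sym (dedup-set xs)) xs~ys)

  card-++ : ∀ xs ys → (∀ {z} → z ∈ xs → z ∉ ys) → card (xs ++ ys) ≡ card xs ℕ.+ card ys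
  card-++ xs ys disjoint = trans (sym (card-unique unique same)) (length-++ (deduplicate _≟_ xs))
    where
      unique : Unique (deduplicate _≟_ xs ++ deduplicate _≟_ ys)
      unique = Unique.++⁺ (deduplicate-! _≟_ xs) (deduplicate-! _≟_ ys)
        (λ (p , q) → disjoint (∈-deduplicate⁻ _≟_ xs p) (∈-deduplicate⁻ _≟_ ys q))
      same : (deduplicate _≟_ xs ++ deduplicate _≟_ ys) ∼[ set ] (xs ++ ys)
      same = ++-cong (⇔.sym (dedup-set xs)) (⇔.sym (dedup-set ys))

  card-∷-∈ : ∀ {z zs} → z ∈ zs → card (z ∷ zs) ≡ card zs
  card-∷-∈ {z} {zs} z∈zs = card-cong (mk⇔ absorb there)
    where
      absorb : ∀ {w} → w ∈ z ∷ zs → w ∈ zs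
      absorb (here refl) = z∈zs
      absorb (there w∈zs) = w∈zs

  card-∷-∉ : ∀ {z zs} → z ∉ zs → card (z ∷ zs) ≡ suc (card zs)
  card-∷-∉ {z} {zs} z∉zs =
    sym (card-unique (fresh ∷ deduplicate-! _≟_ zs) (∷-cong refl (⇔.sym (dedup-set zs))))
    where
      fresh : All (z ≢_) (deduplicate _≟_ zs)
      fresh = All.tabulate (λ w∈ z≡w → z∉zs (subst (_∈ zs) (sym z≡w) (∈-deduplicate⁻ _≟_ zs w∈)))

  card-constant : ∀ {z zs} → z ∈ zs → (∀ {w} → w ∈ zs → w ≡ z) → card zs ≡ 1
  card-constant {z} {zs} z∈zs constant =
    sym (card-unique ([] ∷ []) (mk⇔ (λ { (here refl) → z∈zs }) (λ w∈ → here (constant w∈))))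

module _ {a b c} {X : Set a} {B : Set b} {C : Set c}
         (_≟B_ : DecidableEquality B) (_≟C_ : DecidableEquality C) where
  open Card _≟B_ using () renaming (card to cardB; card-∷-∈ to cardB-∷-∈; card-∷-∉ to cardB-∷-∉)
  open Card _≟C_ using () renaming (card to cardC; card-∷-∈ to cardC-∷-∈; card-∷-∉ to cardC-∷-∉)

  private
    ∈-map-transfer : ∀ {ℓ₁ ℓ₂} {P : Set ℓ₁} {Q : Set ℓ₂} (f : X → P) (h : X → Q) {x} xs →
      (∀ {y} → y ∈ xs → f x ≡ f y → h x ≡ h y) → f x ∈ map f xs → h x ∈ map h xs
    ∈-map-transfer f h xs implies fx∈ with y , y∈xs , fx≡fy ← ∈-map⁻ f fx∈ =
      subst (_∈ map h xs) (sym (implies y∈xs fx≡fy)) (∈-map⁺ h y∈xs)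

  card-map-kernel : (g₁ : X → B) (g₂ : X → C) (xs : List X) →
    (∀ {x y} → x ∈ xs → y ∈ xs → g₁ x ≡ g₁ y ⇔ g₂ x ≡ g₂ y) →
    cardB (map g₁ xs) ≡ cardC (map g₂ xs)
  card-map-kernel g₁ g₂ [] same = refl
  card-map-kernel g₁ g₂ (x ∷ xs) same
    with member? _≟B_ (g₁ x) (map g₁ xs) | member? _≟C_ (g₂ x) (map g₂ xs)
  ... | yes p | yes q = trans (cardB-∷-∈ p) (trans rest (sym (cardC-∷-∈ q)))
    where rest = card-map-kernel g₁ g₂ xs (λ x∈ y∈ → same (there x∈) (there y∈))
  ... | no ¬p | no ¬q = trans (cardB-∷-∉ ¬p) (trans (cong suc rest) (sym (cardC-∷-∉ ¬q)))
    where rest = card-map-kernel g₁ g₂ xs (λ x∈ y∈ → same (there x∈) (there y∈))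
  ... | yes p | no ¬q =
    contradiction (∈-map-transfer g₁ g₂ xs (λ y∈ → to (same (here refl) (there y∈))) p) ¬q
  ... | no ¬p | yes q =
    contradiction (∈-map-transfer g₂ g₁ xs (λ y∈ → from (same (here refl) (there y∈))) q) ¬p

T-ext : ∀ {a b} → (T a ⇔ T b) → a ≡ b
T-ext {false} {false} _ = refl
T-ext {false} {true} a⇔b = ⊥-elim (from a⇔b tt)
T-ext {true} {false} a⇔b = ⊥-elim (to a⇔b tt)
T-ext {true} {true} _ = refl

T-cong : ∀ {a b} → a ≡ b → (T a ⇔ T b)
T-cong refl = mk⇔ (λ t → t) (λ t → t)

T-== : ∀ {n} {i j : Fin n} → T (i == j) ⇔ i ≡ j
T-== {i = i} {j} with i ≟ j
... | yes i≡j = mk⇔ (const i≡j) (const tt)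
... | no i≢j = mk⇔ (λ ()) i≢j

T-≢ : ∀ {n} {u x : Fin n} → T (not (u == x)) ⇔ u ≢ x
T-≢ {u = u} {x} with u ≟ x
... | yes u≡x = mk⇔ (λ ()) (λ u≢x → u≢x u≡x)
... | no u≢x = mk⇔ (const u≢x) (const tt)

T-allFin : ∀ {n} (p : Fin n → Bool) → T (all p (allFin n)) ⇔ (∀ i → T (p i))
T-allFin {n} p = mk⇔ (λ t i → All.lookup (all⁺ p (allFin n) t) (∈-allFin i))
                      (λ f → all⁻ p {allFin n} (All.tabulate (λ {i} _ → f i)))

T-anyFin : ∀ {n} (p : Fin n → Bool) → T (any p (allFin n)) ⇔ (∃ λ i → T (p i))
T-anyFin {n} p = mk⇔ (λ t → let (i , _ , pi) = find (any⁻ p (allFin n) t) in i , pi)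
                      (λ (i , pi) → any⁺ p (lose (∈-allFin i) pi))

T-allFin² : ∀ {n} (p : Fin n → Fin n → Bool) →
  T (all (λ i → all (p i) (allFin n)) (allFin n)) ⇔ (∀ i j → T (p i j))
T-allFin² p = mk⇔ (λ t i → to (T-allFin (p i)) (to (T-allFin _) t i))
                  (λ f → from (T-allFin _) (λ i → from (T-allFin (p i)) (f i)))

T-not∨ : ∀ a b → T (not a ∨ b) ⇔ (T a → T b)
T-not∨ false b = mk⇔ (λ _ ()) (const tt)
T-not∨ true b = mk⇔ (λ tb _ → tb) (λ f → f tt)

T-∨not : ∀ a b → T (b ∨ not a) ⇔ (T a → T b)
T-∨not false b = mk⇔ (λ _ ()) (λ _ → from T-∨ (inj₂ tt))
T-∨not true false = mk⇔ (λ ()) (λ f → f tt)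
T-∨not true true = mk⇔ (λ _ _ → tt) (const tt)

T-¬⇒ : ∀ a b → ¬ (T a → T b) → T a × ¬ T b
T-¬⇒ true b fails = tt , λ tb → fails (const tb)
T-¬⇒ false b fails = ⊥-elim (fails λ ())

isInjective-correct : ∀ {h n} (f : Vec (Fin n) h) →
  T (isInjective f) ⇔ (∀ i j → lookup f i ≡ lookup f j → i ≡ j)
isInjective-correct f = ⇔.trans (T-allFin² _) (mk⇔
  (λ t i j e → to T-== (to (T-∨not (lookup f i == lookup f j) (i == j)) (t i j) (from T-== e)))
  (λ inj i j → from (T-∨not (lookup f i == lookup f j) (i == j)) (λ t → from T-== (inj i j (to T-== t)))))

isHom-correct : ∀ {h n} (H : Graph h) (G : Graph n) (f : Vec (Fin n) h) →
  T (isHom H G f) ⇔ (∀ i j → adj H i j ≡ true → adj G (lookup f i) (lookup f j) ≡ true)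
isHom-correct H G f = ⇔.trans (T-allFin² _) (mk⇔
  (λ t i j a → to T-≡ (to (T-not∨ (adj H i j) _) (t i j) (from T-≡ a)))
  (λ hom i j → from (T-not∨ (adj H i j) _) (λ t → from T-≡ (hom i j (to T-≡ t)))))

record IsEmbedding {h n} (H : Graph h) (G : Graph n) (f : Vec (Fin n) h) : Set where
  field
    injective : ∀ i j → lookup f i ≡ lookup f j → i ≡ j
    preserves : ∀ i j → adj H i j ≡ true → adj G (lookup f i) (lookup f j) ≡ true
open IsEmbedding public

∈-allVecs : ∀ h n (f : Vec (Fin n) h) → f ∈ allVecs h n
∈-allVecs zero n [] = here refl
∈-allVecs (suc h) n (x ∷ f) =
  ∈-concatMap⁺ (λ y → map (y ∷_) (allVecs h n)) (lose (∈-allFin x) (∈-map⁺ (x ∷_) (∈-allVecs h n f)))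

embeddings : ∀ {h n} → Graph h → Graph n → List (Vec (Fin n) h)
embeddings {h} {n} H G = filter (λ f → T? (isInjective f ∧ isHom H G f)) (allVecs h n)

∈-embeddings : ∀ {h n} {H : Graph h} {G : Graph n} {f} → f ∈ embeddings H G ⇔ IsEmbedding H G f
∈-embeddings {h} {n} {H} {G} {f} = mk⇔
  (λ f∈ → let (t₁ , t₂) = to T-∧ (proj₂ (∈-filter⁻ test {xs = allVecs h n} f∈))
          in record { injective = to (isInjective-correct f) t₁ ; preserves = to (isHom-correct H G f) t₂ })
  (λ emb → ∈-filter⁺ test (∈-allVecs h n f)
     (from T-∧ (from (isInjective-correct f) (injective emb) , from (isHom-correct H G f) (preserves emb))))
  where test = λ f → T? (isInjective f ∧ isHom H G f)

InCopy : ∀ {h n} → Vec (Fin n) h → Fin n → Set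
InCopy f v = ∃ λ i → lookup f i ≡ v

EdgeOfCopy : ∀ {h n} → Graph h → Vec (Fin n) h → Fin n → Fin n → Set
EdgeOfCopy H f v w = ∃₂ λ i j → adj H i j ≡ true × lookup f i ≡ v × lookup f j ≡ w

SameCopy : ∀ {h n} → Graph h → Vec (Fin n) h → Vec (Fin n) h → Set
SameCopy H f g = (∀ v → InCopy f v ⇔ InCopy g v) × (∀ v w → EdgeOfCopy H f v w ⇔ EdgeOfCopy H g v w)

T-vertex : ∀ {h n} (f : Vec (Fin n) h) v →
  T (any (λ i → lookup f i == v) (allFin h)) ⇔ InCopy f v
T-vertex f v = ⇔.trans (T-anyFin _) (mk⇔ (λ (i , t) → i , to T-== t) (λ (i , e) → i , from T-== e))

T-edge : ∀ {h n} (H : Graph h) (f : Vec (Fin n) h) v w →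
  T (any (λ i → any (λ j → adj H i j ∧ (lookup f i == v) ∧ (lookup f j == w)) (allFin h)) (allFin h))
    ⇔ EdgeOfCopy H f v w
T-edge H f v w = ⇔.trans (T-anyFin _) (mk⇔ decode encode)
  where
    decode : _ → EdgeOfCopy H f v w
    decode (i , t) with j , t′ ← to (T-anyFin _) t
                   with a , t″ ← to T-∧ t′
                   with b , c ← to T-∧ t″ = i , j , to T-≡ a , to T-== b , to T-== c
    encode : EdgeOfCopy H f v w → _
    encode (i , j , a , b , c) =
      i , from (T-anyFin _) (j , from T-∧ (from T-≡ a , from T-∧ (from T-== b , from T-== c)))

image-≡⇔ : ∀ {h n} (H : Graph h) (f g : Vec (Fin n) h) → image H f ≡ image H g ⇔ SameCopy H f g
image-≡⇔ H f g = mk⇔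
  (λ e → (λ v → ⇔.trans (⇔.sym (T-vertex f v)) (⇔.trans (T-cong (vertex-entry e v)) (T-vertex g v))) ,
         (λ v w → ⇔.trans (⇔.sym (T-edge H f v w)) (⇔.trans (T-cong (edge-entry e v w)) (T-edge H g v w))))
  (λ (same-v , same-e) → cong₂ _,_
     (tabulate-cong λ v → T-ext (⇔.trans (T-vertex f v) (⇔.trans (same-v v) (⇔.sym (T-vertex g v)))))
     (tabulate-cong λ v → tabulate-cong λ w →
        T-ext (⇔.trans (T-edge H f v w) (⇔.trans (same-e v w) (⇔.sym (T-edge H g v w))))))
  where
    vertex-entry : image H f ≡ image H g → ∀ v → _
    vertex-entry e v = trans (sym (lookup∘tabulate _ v))
      (trans (cong (λ im → lookup (proj₁ im) v) e) (lookup∘tabulate _ v))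
    table-entry : ∀ {m} {A : Set} (F : Fin m → Fin m → A) v w →
      lookup (lookup (tabulate (λ v → tabulate (F v))) v) w ≡ F v w
    table-entry F v w = trans (cong (λ row → lookup row w) (lookup∘tabulate _ v)) (lookup∘tabulate _ w)
    edge-entry : image H f ≡ image H g → ∀ v w → _
    edge-entry e v w = trans (sym (table-entry _ v w))
      (trans (cong (λ im → lookup (lookup (proj₂ im) v) w) e) (table-entry _ v w))

Image : ∀ {A B : Set} → (A → B) → (A → Set) → B → Set
Image e P b = ∃ λ a → e a ≡ b × P a

Image-cong : ∀ {A B : Set} (e : A → B) {P Q : A → Set} →
  (∀ a → P a ⇔ Q a) → ∀ b → Image e P b ⇔ Image e Q b
Image-cong e P⇔Q b = mk⇔ (λ (a , ea≡b , pa) → a , ea≡b , to (P⇔Q a) pa)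
                         (λ (a , ea≡b , qa) → a , ea≡b , from (P⇔Q a) qa)

Image-reflect : ∀ {A B : Set} (e : A → B) → (∀ a a′ → e a ≡ e a′ → a ≡ a′) → {P Q : A → Set} →
  (∀ b → Image e P b ⇔ Image e Q b) → ∀ a → P a ⇔ Q a
Image-reflect e e-inj same a = mk⇔ (reflect same) (reflect (λ b → ⇔.sym (same b)))
  where
    reflect : ∀ {P Q : _ → Set} → (∀ b → Image e P b ⇔ Image e Q b) → P a → Q a
    reflect {Q = Q} same′ pa with a′ , ea′≡ea , qa′ ← to (same′ (e a)) (a , refl , pa) =
      subst Q (e-inj a′ a ea′≡ea) qa′

both : ∀ {A B : Set} → (A → B) → A × A → B × B
both e (x , y) = e x , e y

both-injective : ∀ {A B : Set} {e : A → B} → (∀ x y → e x ≡ e y → x ≡ y) →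
  ∀ p q → both e p ≡ both e q → p ≡ q
both-injective e-inj (x , y) (x′ , y′) e≡ =
  let (p , q) = ,-injective e≡ in cong₂ _,_ (e-inj x x′ p) (e-inj y y′ q)

module Pushforward {a n} (e : Fin a → Fin n) where

  InCopy-map : ∀ {h} (f : Vec (Fin a) h) v → InCopy (Vec.map e f) v ⇔ Image e (InCopy f) v
  InCopy-map f v = mk⇔
    (λ (i , fi≡v) → lookup f i , trans (sym (lookup-map i e f)) fi≡v , i , refl)
    (λ (u , eu≡v , i , fi≡u) → i , trans (lookup-map i e f) (trans (cong e fi≡u) eu≡v))

  EdgeOfCopy-map : ∀ {h} (H : Graph h) (f : Vec (Fin a) h) v w →
    EdgeOfCopy H (Vec.map e f) v w ⇔ Image (both e) (λ (x , y) → EdgeOfCopy H f x y) (v , w)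
  EdgeOfCopy-map H f v w = mk⇔
    (λ (i , j , aij , fi≡v , fj≡w) → (lookup f i , lookup f j) ,
        cong₂ _,_ (trans (sym (lookup-map i e f)) fi≡v) (trans (sym (lookup-map j e f)) fj≡w) ,
        i , j , aij , refl , refl)
    (λ ((x , y) , exy≡vw , i , j , aij , fi≡x , fj≡y) → let (ex≡v , ey≡w) = ,-injective exy≡vw in
        i , j , aij , trans (lookup-map i e f) (trans (cong e fi≡x) ex≡v)
                    , trans (lookup-map j e f) (trans (cong e fj≡y) ey≡w))

  SameCopy-map : (∀ i j → e i ≡ e j → i ≡ j) → ∀ {h} (H : Graph h) (f g : Vec (Fin a) h) →
    SameCopy H f g ⇔ SameCopy H (Vec.map e f) (Vec.map e g)
  SameCopy-map e-inj H f g = mk⇔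
    (λ (same-v , same-e) →
       (λ v → ⇔.trans (InCopy-map f v) (⇔.trans (Image-cong e same-v v) (⇔.sym (InCopy-map g v)))) ,
       (λ v w → ⇔.trans (EdgeOfCopy-map H f v w)
                  (⇔.trans (Image-cong (both e) (λ (x , y) → same-e x y) (v , w)) (⇔.sym (EdgeOfCopy-map H g v w)))))
    (λ (same-v , same-e) →
       Image-reflect e e-inj (λ v → ⇔.trans (⇔.sym (InCopy-map f v)) (⇔.trans (same-v v) (InCopy-map g v))) ,
       (λ x y → Image-reflect (both e) (both-injective e-inj)
          (λ (v , w) → ⇔.trans (⇔.sym (EdgeOfCopy-map H f v w)) (⇔.trans (same-e v w) (EdgeOfCopy-map H g v w)))
          (x , y)))

_≟ᶜ_ : ∀ {n} → DecidableEquality (SubgraphData n)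
_≟ᶜ_ = Product.≡-dec (VecP.≡-dec _≟ᵇ_) (VecP.≡-dec (VecP.≡-dec _≟ᵇ_))

-- By definition, copies H G = card (map (image H) (embeddings H G)).
module _ {n : ℕ} where
  open Card (_≟ᶜ_ {n}) public using (card)

-- The weight |V(G)| + |E(G)| of a graph, edges counted as ordered pairs.
edgeList : ∀ {n} → Graph n → List (Fin n × Fin n)
edgeList {n} G = filter (λ (x , y) → adj G x y ≟ᵇ true) (cartesianProduct (allFin n) (allFin n))

weight : ∀ {n} → Graph n → ℕ
weight {n} G = n ℕ.+ length (edgeList G)

∈-edgeList : ∀ {n} (G : Graph n) {x y} → (x , y) ∈ edgeList G ⇔ adj G x y ≡ true
∈-edgeList {n} G = mk⇔ (λ p → proj₂ (∈-filter⁻ test {xs = cartesianProduct (allFin n) (allFin n)} p))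
                       (λ a → ∈-filter⁺ test (∈-cartesianProduct⁺ (∈-allFin _) (∈-allFin _)) a)
  where test = λ ((x , y) : Fin n × Fin n) → adj G x y ≟ᵇ true

edgeList-unique : ∀ {n} (G : Graph n) → Unique (edgeList G)
edgeList-unique {n} G = Unique.filter⁺ _ (Unique.cartesianProduct⁺ (Unique.allFin⁺ n) (Unique.allFin⁺ n))

module Embedding {a b} {G : Graph a} {K : Graph b} (φ : Fin a → Fin b)
  (φ-inj : ∀ i j → φ i ≡ φ j → i ≡ j)
  (φ-hom : ∀ i j → adj G i j ≡ true → adj K (φ i) (φ j) ≡ true) where

  vertexImage : List (Fin b)
  vertexImage = map φ (allFin a)

  edgeImage : List (Fin b × Fin b)
  edgeImage = map (both φ) (edgeList G)

  vertexImage-unique : Unique vertexImage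
  vertexImage-unique = Unique.map⁺ (λ {i} {j} → φ-inj i j) (Unique.allFin⁺ a)

  edgeImage-unique : Unique edgeImage
  edgeImage-unique = Unique.map⁺ (λ {p} {q} → both-injective φ-inj p q) (edgeList-unique G)

  edgeImage⊆ : ∀ {p} → p ∈ edgeImage → p ∈ edgeList K
  edgeImage⊆ p∈ with (i , j) , ij∈ , refl ← ∈-map⁻ (both φ) p∈ =
    from (∈-edgeList K) (φ-hom i j (to (∈-edgeList G) ij∈))

  length-vertexImage : length vertexImage ≡ a
  length-vertexImage = trans (length-map φ (allFin a)) (length-tabulate _)

  vertices≤ : a ≤ b
  vertices≤ = injective⇒≤ (λ {i} {j} → φ-inj i j)

  edges≤ : length (edgeList G) ≤ length (edgeList K)
  edges≤ = subst (_≤ length (edgeList K)) (length-map (both φ) (edgeList G))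
                 (⊆⇒length≤ edgeImage-unique edgeImage⊆)

  weight≤ : weight G ≤ weight K
  weight≤ = +-mono-≤ vertices≤ edges≤

  weight< : a < b → weight G < weight K
  weight< a<b = +-mono-<-≤ a<b edges≤

  module EqualWeight (same : weight G ≡ weight K) where

    vertices≡ : a ≡ b
    vertices≡ with m≤n⇒m<n∨m≡n vertices≤
    ... | inj₂ a≡b = a≡b
    ... | inj₁ a<b = contradiction same (λ e → <-irrefl e (weight< a<b))

    edges≡ : length (edgeList G) ≡ length (edgeList K)
    edges≡ = +-cancelˡ-≡ a _ _ (trans same (cong (ℕ._+ length (edgeList K)) (sym vertices≡)))

    -- φ hits every vertex: otherwise its image would be shorter than allFin b.
    surjective : ∀ y → ∃ λ x → φ x ≡ y
    surjective y with member? _≟_ y vertexImage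
    ... | yes y∈ = let (x , _ , y≡φx) = ∈-map⁻ φ y∈ in x , sym y≡φx
    ... | no y∉ = contradiction (⊂⇒length< vertexImage-unique (λ _ → ∈-allFin _) (∈-allFin y) y∉)
                    (<-irrefl (trans length-vertexImage (trans vertices≡ (sym (length-tabulate _)))))

    -- φ reflects adjacency: an extra edge of K would make its edge list longer.
    reflects : ∀ i j → adj K (φ i) (φ j) ≡ adj G i j
    reflects i j with adj G i j in aG
    ... | true = φ-hom i j aG
    ... | false with adj K (φ i) (φ j) in aK
    ...   | false = refl
    ...   | true = contradiction (⊂⇒length< edgeImage-unique edgeImage⊆ (from (∈-edgeList K) aK) missing)
                     (<-irrefl (trans (length-map (both φ) (edgeList G)) edges≡))
      where
        missing : (φ i , φ j) ∉ edgeImage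
        missing p with (i′ , j′) , ij∈ , e ← ∈-map⁻ (both φ) p with refl ← both-injective φ-inj _ _ e =
          contradiction (trans (sym (to (∈-edgeList G) ij∈)) aG) λ ()

    iso : Iso G K
    iso = record
      { bij = mk↔ₛ′ φ (λ y → proj₁ (surjective y)) (λ y → proj₂ (surjective y))
                      (λ x → φ-inj _ _ (proj₂ (surjective (φ x))))
      ; preserve = reflects }

Iso-sym : ∀ {a b} {G : Graph a} {K : Graph b} → Iso G K → Iso K G
Iso-sym {G = G} {K} i = record
  { bij = mk↔ₛ′ (Inverse.from bij) (Inverse.to bij) (Inverse.strictlyInverseʳ bij) (Inverse.strictlyInverseˡ bij)
  ; preserve = λ x y → trans (sym (preserve (Inverse.from bij x) (Inverse.from bij y)))
                             (cong₂ (adj K) (Inverse.strictlyInverseˡ bij x) (Inverse.strictlyInverseˡ bij y)) }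
  where open Iso i

module VecEmbedding {h n} {H : Graph h} {G : Graph n} {f : Vec (Fin n) h} (emb : IsEmbedding H G f) =
  Embedding {G = H} {K = G} (lookup f) (injective emb) (preserves emb)

copies-zero-or-embedding : ∀ {h n} (H : Graph h) (G : Graph n) →
  copies H G ≡ 0 ⊎ ∃ (IsEmbedding H G)
copies-zero-or-embedding H G with embeddings H G in eq
... | [] = inj₁ refl
... | f ∷ _ = inj₂ (f , to ∈-embeddings (subst (f ∈_) (sym eq) (here refl)))

copies-self : ∀ {h} (H : Graph h) → copies H H ≡ 1
copies-self {h} H = Card.card-constant _≟ᶜ_ (∈-map⁺ (image H) (from ∈-embeddings id-embedding)) same-as-id
  where
    idV : Vec (Fin h) h
    idV = tabulate (λ x → x)
    lookup-idV : ∀ i → lookup idV i ≡ i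
    lookup-idV = lookup∘tabulate (λ x → x)
    id-embedding : IsEmbedding H H idV
    id-embedding = record
      { injective = λ i j e → trans (sym (lookup-idV i)) (trans e (lookup-idV j))
      ; preserves = λ i j a → subst₂ (λ x y → adj H x y ≡ true) (sym (lookup-idV i)) (sym (lookup-idV j)) a }
    edge-of-id : ∀ v w → EdgeOfCopy H idV v w ⇔ adj H v w ≡ true
    edge-of-id v w = mk⇔
      (λ (i , j , a , p , q) →
         subst₂ (λ x y → adj H x y ≡ true) (trans (sym (lookup-idV i)) p) (trans (sym (lookup-idV j)) q) a)
      (λ a → v , w , a , lookup-idV v , lookup-idV w)
    -- a self-embedding does not change the weight, so it is onto and reflects
    -- adjacency; hence it has the same image as the identity
    same-as-id : ∀ {c} → c ∈ map (image H) (embeddings H H) → c ≡ image H idV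
    same-as-id c∈ with f , f∈ , refl ← ∈-map⁻ (image H) c∈ = from (image-≡⇔ H f idV)
      ( (λ v → mk⇔ (λ _ → v , lookup-idV v) (λ _ → surjective v)) ,
        (λ v w → ⇔.trans (mk⇔ (edge⇒ v w) (edge⇐ v w)) (⇔.sym (edge-of-id v w))) )
      where
        emb : IsEmbedding H H f
        emb = to ∈-embeddings f∈
        open VecEmbedding emb
        open EqualWeight refl
        edge⇒ : ∀ v w → EdgeOfCopy H f v w → adj H v w ≡ true
        edge⇒ v w (i , j , a , p , q) = subst₂ (λ x y → adj H x y ≡ true) p q (preserves emb i j a)
        edge⇐ : ∀ v w → adj H v w ≡ true → EdgeOfCopy H f v w
        edge⇐ v w a with x , refl ← surjective v | y , refl ← surjective w =
          x , y , trans (sym (reflects x y)) a , refl , refl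

-- In the forward direction this holds for H itself and for
-- the pieces of a split of H, so heavier terms do not contribute there.
NoLargeCopies : ∀ {h k} → Graph h → Graph k → Set
NoLargeCopies H K = ∀ {m} (F : Graph m) → ¬ Iso F H → weight H ≤ weight F → copies F K ≡ 0

no-large-copies-self : ∀ {h} (H : Graph h) → NoLargeCopies H H
no-large-copies-self H F F≇H H≤F with copies-zero-or-embedding F H
... | inj₁ none = none
... | inj₂ (f , emb) = contradiction (EqualWeight.iso (≤-antisym weight≤ H≤F)) F≇H
  where open VecEmbedding emb

no-large-copies-smaller : ∀ {h k} (H : Graph h) (K : Graph k) → weight K < weight H → NoLargeCopies H K
no-large-copies-smaller H K K<H F F≇H H≤F with copies-zero-or-embedding F K
... | inj₁ none = none
... | inj₂ (f , emb) = contradiction (<-≤-trans K<H (≤-trans H≤F weight≤)) (<-irrefl refl)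
  where open VecEmbedding emb

walk-map : ∀ {n} {G : Graph n} {P Q : Fin n → Set} → (∀ {w} → P w → Q w) →
  ∀ {u v} → Walk G P u v → Walk G Q u v
walk-map P⇒Q (here pu) = here (P⇒Q pu)
walk-map P⇒Q (step pu a rest) = step (P⇒Q pu) a (walk-map P⇒Q rest)

walk-start : ∀ {n} {G : Graph n} {P : Fin n → Set} {u v} → Walk G P u v → P u
walk-start (here pu) = pu
walk-start (step pu _ _) = pu

module _ {n} {G : Graph n} {P : Fin n → Set} where

  walk-snoc : ∀ {u w v} → Walk G P u w → adj G w v ≡ true → P v → Walk G P u v
  walk-snoc (here pu) a pv = step pu a (here pv)
  walk-snoc (step pu a rest) a′ pv = step pu a (walk-snoc rest a′ pv)

  walk-++ : ∀ {u w v} → Walk G P u w → Walk G P w v → Walk G P u v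
  walk-++ (here _) rest = rest
  walk-++ (step pu a walk) rest = step pu a (walk-++ walk rest)

  walk-reverse : ∀ {u v} → Walk G P u v → Walk G P v u
  walk-reverse (here pu) = here pu
  walk-reverse {u} (step {w = w} pu a rest) = walk-snoc (walk-reverse rest) (trans (Graph.sym G w u) a) pu

module Union {n a b} {G : Graph n} {G₁ : Graph a} {G₂ : Graph b} (u : UnionAtMostOneCommon G G₁ G₂) where
  open UnionAtMostOneCommon u public renaming (inj₁ to e₁-injective; inj₂ to e₂-injective)

  OnSide₁ OnSide₂ : Fin n → Set
  OnSide₁ v = ∃ λ i → e₁ i ≡ v
  OnSide₂ v = ∃ λ j → e₂ j ≡ v

  onSide₁? : ∀ v → Dec (OnSide₁ v)
  onSide₁? v = Fin.any? (λ i → e₁ i ≟ v)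

  onSide₂? : ∀ v → Dec (OnSide₂ v)
  onSide₂? v = Fin.any? (λ j → e₂ j ≟ v)

  shared-unique : ∀ {v w} → OnSide₁ v → OnSide₂ v → OnSide₁ w → OnSide₂ w → v ≡ w
  shared-unique (i , refl) (j , e₂j≡) (i′ , refl) (j′ , e₂j′≡) =
    cong e₁ (common i j i′ j′ (sym e₂j≡) (sym e₂j′≡))

  e₁-preserves : ∀ i j → adj G₁ i j ≡ true → adj G (e₁ i) (e₁ j) ≡ true
  e₁-preserves i j a = from (edges (e₁ i) (e₁ j)) (inj₁ (i , j , refl , refl , a))

  swap : UnionAtMostOneCommon G G₂ G₁
  swap = record
    { e₁ = e₂ ; e₂ = e₁ ; inj₁ = e₂-injective ; inj₂ = e₁-injective
    ; cover = λ x → Sum.swap (cover x)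
    ; edges = λ x y → mk⇔ (Sum.swap ∘ to (edges x y)) (from (edges x y) ∘ Sum.swap)
    ; common = λ j i j′ i′ e e′ →
        e₂-injective j j′ (trans e (trans (cong e₁ (common i j i′ j′ (sym e) (sym e′))) (sym e′))) }

module Side {n a b} {G : Graph n} {G₁ : Graph a} {G₂ : Graph b} (u : UnionAtMostOneCommon G G₁ G₂)
            {h} (H : Graph h) where
  open Union u

  push : ∀ {g} → IsEmbedding H G₁ g → IsEmbedding H G (Vec.map e₁ g)
  push {g} emb = record
    { injective = λ i j e → injective emb i j
        (e₁-injective _ _ (trans (sym (lookup-map i e₁ g)) (trans e (lookup-map j e₁ g))))
    ; preserves = λ i j a → subst₂ (λ x y → adj G x y ≡ true)
        (sym (lookup-map i e₁ g)) (sym (lookup-map j e₁ g)) (e₁-preserves _ _ (preserves emb i j a)) }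

  pull : ∀ {f} → IsEmbedding H G f → (∀ i → OnSide₁ (lookup f i)) →
    ∃ λ g → IsEmbedding H G₁ g × Vec.map e₁ g ≡ f
  pull {f} emb on₁ = g , record { injective = g-inj ; preserves = g-hom } , map-g
    where
      g : Vec (Fin a) h
      g = tabulate (λ i → proj₁ (on₁ i))
      e₁g : ∀ i → e₁ (lookup g i) ≡ lookup f i
      e₁g i = trans (cong e₁ (lookup∘tabulate _ i)) (proj₂ (on₁ i))
      map-g : Vec.map e₁ g ≡ f
      map-g = trans (sym (tabulate-∘ e₁ _)) (trans (tabulate-cong (λ i → proj₂ (on₁ i))) (tabulate∘lookup f))
      g-inj : ∀ i j → lookup g i ≡ lookup g j → i ≡ j
      g-inj i j e = injective emb i j (trans (sym (e₁g i)) (trans (cong e₁ e) (e₁g j)))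
      -- an edge of the copy is an edge of G₁, since an edge of G₂ between
      -- two shared vertices would be a loop
      g-hom : ∀ i j → adj H i j ≡ true → adj G₁ (lookup g i) (lookup g j) ≡ true
      g-hom i j a with to (edges (lookup f i) (lookup f j)) (preserves emb i j a)
      ... | inj₁ (i′ , j′ , p , q , a′) =
        subst₂ (λ x y → adj G₁ x y ≡ true) (e₁-injective _ _ (trans p (sym (e₁g i))))
                                            (e₁-injective _ _ (trans q (sym (e₁g j)))) a′
      ... | inj₂ (i′ , j′ , p , q , _)
        with refl ← injective emb i j (shared-unique (_ , e₁g i) (i′ , p) (_ , e₁g j) (j′ , q)) =
          contradiction (trans (sym a) (irrefl H i)) λ ()

  sideCopies : List (SubgraphData n)
  sideCopies = map (image H ∘ Vec.map e₁) (embeddings H G₁)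

  -- e₁ maps distinct copies to distinct copies
  copies-side : copies H G₁ ≡ card sideCopies
  copies-side = card-map-kernel _≟ᶜ_ _≟ᶜ_ (image H) (image H ∘ Vec.map e₁) (embeddings H G₁)
    λ {g} {g′} _ _ → ⇔.trans (image-≡⇔ H g g′)
      (⇔.trans (Pushforward.SameCopy-map e₁ e₁-injective H g g′)
               (⇔.sym (image-≡⇔ H (Vec.map e₁ g) (Vec.map e₁ g′))))

-- Copies of a 2-connected graph H in a union G = G₁ ∪ G₂ with at most one
-- common vertex: each lies entirely in G₁ or entirely in G₂, and the two
-- kinds are different, so H(G) = H(G₁) + H(G₂).
module Additivity {h} {H : Graph h} (tc : TwoConnected H)
                  {n a b} {G : Graph n} {G₁ : Graph a} {G₂ : Graph b} (u : UnionAtMostOneCommon G G₁ G₂) where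
  open Union u
  module S₁ = Side u H
  module S₂ = Side swap H

  module _ {f : Vec (Fin n) h} (emb : IsEmbedding H G f) where

    Unshared : Fin h → Set
    Unshared w = ¬ (OnSide₁ (lookup f w) × OnSide₂ (lookup f w))

    -- A walk of H avoiding the preimage of the shared vertex never crosses to side 1:
    -- each step follows an edge of G₁ or G₂, and an edge of G₁ starts on side 1.
    stays-off-side₁ : ∀ {v w} → Walk H Unshared v w → ¬ OnSide₁ (lookup f v) → ¬ OnSide₁ (lookup f w)
    stays-off-side₁ (here _) off₁ = off₁
    stays-off-side₁ {v} (step {w = w} _ a rest) off₁ with to (edges (lookup f v) (lookup f w)) (preserves emb v w a)
    ... | inj₁ (i , _ , e₁i≡ , _ , _) = contradiction (i , e₁i≡) off₁
    ... | inj₂ (_ , j , _ , e₂j≡ , _) = stays-off-side₁ rest (λ on₁ → walk-start rest (on₁ , j , e₂j≡))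

    -- By 2-connectedness, a vertex off side 1 and a vertex off side 2 are joined
    -- by a walk avoiding the preimage of the shared vertex.
    unshared-walk : ∀ i₀ i → ¬ OnSide₁ (lookup f i₀) → ¬ OnSide₂ (lookup f i) → Walk H Unshared i₀ i
    unshared-walk i₀ i off₁ off₂ with Fin.any? (λ x → onSide₁? (lookup f x) ×-dec onSide₂? (lookup f x))
    ... | yes (x , x₁ , x₂) =
      walk-map avoid (proj₂ (proj₂ tc) x i₀ i (λ { refl → off₁ x₁ }) (λ { refl → off₂ x₂ }))
      where
        avoid : ∀ {w} → w ≢ x → Unshared w
        avoid w≢x (w₁ , w₂) = w≢x (injective emb _ _ (shared-unique w₁ w₂ x₁ x₂))
    ... | no none = walk-map (λ {w} _ shared → none (w , shared)) (proj₁ (proj₂ tc) i₀ i)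

    one-side : (∀ i → OnSide₁ (lookup f i)) ⊎ (∀ i → OnSide₂ (lookup f i))
    one-side with Fin.all? (λ i → onSide₁? (lookup f i))
    ... | yes all₁ = inj₁ all₁
    ... | no ¬all₁ = inj₂ on₂
      where
        i₀ = proj₁ (Fin.¬∀⟶∃¬ h _ (λ i → onSide₁? (lookup f i)) ¬all₁)
        off₁ = proj₂ (Fin.¬∀⟶∃¬ h _ (λ i → onSide₁? (lookup f i)) ¬all₁)
        on₂ : ∀ i → OnSide₂ (lookup f i)
        on₂ i with onSide₂? (lookup f i) | cover (lookup f i)
        ... | yes on | _ = on
        ... | no _ | inj₂ on = on
        ... | no off₂ | inj₁ on₁ = contradiction on₁ (stays-off-side₁ (unshared-walk i₀ i off₁ off₂) off₁)

  -- A copy from G₁ is never a copy from G₂: two of its vertices would be shared.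
  sides-differ : ∀ {g g′} → IsEmbedding H G₁ g → ¬ SameCopy H (Vec.map e₁ g) (Vec.map e₂ g′)
  sides-differ {g} {g′} emb (same-v , _) = x≢y (injective emb x y (e₁-injective _ _ (shared-unique
      (_ , refl) (also-on₂ x) (_ , refl) (also-on₂ y))))
    where
      two-vertices : ∀ {k} → 2 ≤ k → Σ (Fin k) λ x → Σ (Fin k) λ y → x ≢ y
      two-vertices (s≤s (s≤s _)) = zero , suc zero , λ ()
      x = proj₁ (two-vertices (proj₁ tc))
      y = proj₁ (proj₂ (two-vertices (proj₁ tc)))
      x≢y = proj₂ (proj₂ (two-vertices (proj₁ tc)))
      also-on₂ : ∀ i → OnSide₂ (e₁ (lookup g i))
      also-on₂ i with k , p ← to (same-v (e₁ (lookup g i))) (i , lookup-map i e₁ g) =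
        lookup g′ k , trans (sym (lookup-map k e₂ g′)) p

  copies-additive : copies H G ≡ copies H G₁ ℕ.+ copies H G₂
  copies-additive = begin
    copies H G
      ≡⟨ Card.card-cong _≟ᶜ_ (mk⇔ split join) ⟩
    card (S₁.sideCopies ++ S₂.sideCopies)
      ≡⟨ Card.card-++ _≟ᶜ_ S₁.sideCopies S₂.sideCopies disjoint ⟩
    card S₁.sideCopies ℕ.+ card S₂.sideCopies
      ≡⟨ sym (cong₂ ℕ._+_ S₁.copies-side S₂.copies-side) ⟩
    copies H G₁ ℕ.+ copies H G₂ ∎
    where
      open ≡-Reasoning
      split : ∀ {c} → c ∈ map (image H) (embeddings H G) → c ∈ S₁.sideCopies ++ S₂.sideCopies
      split c∈ with f , f∈ , refl ← ∈-map⁻ (image H) c∈ with one-side (to ∈-embeddings f∈)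
      ... | inj₁ on₁ with g , emb , refl ← S₁.pull (to ∈-embeddings f∈) on₁ =
        ∈-++⁺ˡ (∈-map⁺ (image H ∘ Vec.map e₁) (from ∈-embeddings emb))
      ... | inj₂ on₂ with g , emb , refl ← S₂.pull (to ∈-embeddings f∈) on₂ =
        ∈-++⁺ʳ S₁.sideCopies (∈-map⁺ (image H ∘ Vec.map e₂) (from ∈-embeddings emb))
      join : ∀ {c} → c ∈ S₁.sideCopies ++ S₂.sideCopies → c ∈ map (image H) (embeddings H G)
      join c∈ with ∈-++⁻ S₁.sideCopies c∈
      ... | inj₁ c∈₁ with g , g∈ , refl ← ∈-map⁻ (image H ∘ Vec.map e₁) c∈₁ =
        ∈-map⁺ (image H) (from ∈-embeddings (S₁.push (to ∈-embeddings g∈)))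
      ... | inj₂ c∈₂ with g , g∈ , refl ← ∈-map⁻ (image H ∘ Vec.map e₂) c∈₂ =
        ∈-map⁺ (image H) (from ∈-embeddings (S₂.push (to ∈-embeddings g∈)))
      disjoint : ∀ {c} → c ∈ S₁.sideCopies → c ∉ S₂.sideCopies
      disjoint c∈₁ c∈₂ with g , g∈ , refl ← ∈-map⁻ (image H ∘ Vec.map e₁) c∈₁
                       with g′ , _ , same ← ∈-map⁻ (image H ∘ Vec.map e₂) c∈₂ =
        sides-differ {g′ = g′} (to ∈-embeddings g∈) (to (image-≡⇔ H (Vec.map e₁ g) (Vec.map e₂ g′)) same)

members : ∀ {n} → (Fin n → Bool) → List (Fin n)
members {n} S = filter (T? ∘ S) (allFin n)

∈-members : ∀ {n} {S : Fin n → Bool} {v} → v ∈ members S ⇔ T (S v)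
∈-members {n} {S} =
  mk⇔ (λ v∈ → proj₂ (∈-filter⁻ (T? ∘ S) {xs = allFin n} v∈)) (∈-filter⁺ (T? ∘ S) (∈-allFin _))

members-⊂ : ∀ {n} {S S′ : Fin n → Bool} → (∀ v → T (S v) → T (S′ v)) →
  ∀ v → T (S′ v) → ¬ T (S v) → length (members S) < length (members S′)
members-⊂ {n} S⊆S′ v v∈S′ v∉S =
  ⊂⇒length< (Unique.filter⁺ _ (Unique.allFin⁺ n)) (λ z∈ → from ∈-members (S⊆S′ _ (to ∈-members z∈)))
    (from ∈-members v∈S′) (v∉S ∘ to ∈-members)

length-members≤ : ∀ {n} (S : Fin n → Bool) → length (members S) ≤ n
length-members≤ {n} S = subst (length (members S) ≤_) (length-tabulate (λ i → i))
  (⊆⇒length≤ (Unique.filter⁺ (T? ∘ S) (Unique.allFin⁺ n)) (λ _ → ∈-allFin _))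

-- An increasing chain of subsets of Fin n is eventually stationary:
-- while it keeps growing, the k-th set has at least k elements.
stabilises : ∀ {n} (R : ℕ → Fin n → Bool) → (∀ k v → T (R k v) → T (R (suc k) v)) →
  ∃ λ k → ∀ v → T (R (suc k) v) → T (R k v)
stabilises {n} R increasing with grows (suc n)
  where
    Stationary = λ k → ∀ v → T (R (suc k) v) → T (R k v)
    grows : ∀ m → (∃ Stationary) ⊎ m ≤ length (members (R m))
    grows zero = inj₂ z≤n
    grows (suc m) with grows m
    ... | inj₁ stationary = inj₁ stationary
    ... | inj₂ m≤ with Fin.all? (λ v → T? (R (suc m) v) →-dec T? (R m v))
    ...   | yes stationary = inj₁ (m , stationary)
    ...   | no moving with v , new ← Fin.¬∀⟶∃¬ n _ (λ v → T? (R (suc m) v) →-dec T? (R m v)) moving =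
      let (in-next , not-in-current) = T-¬⇒ (R (suc m) v) (R m v) new
      in inj₂ (≤-<-trans m≤ (members-⊂ (increasing m) v in-next not-in-current))
... | inj₁ stationary = stationary
... | inj₂ n<members = contradiction (<-≤-trans n<members (length-members≤ (R (suc n)))) (<-irrefl refl)

-- The set of vertices reachable from u₀ by walks through `ok` vertices,
-- computed as the limit of the sets reachable in at most k steps.
module Reach {n} (H : Graph n) (ok : Fin n → Bool) (u₀ : Fin n) (ok₀ : T (ok u₀)) where

  OK : Fin n → Set
  OK v = T (ok v)

  Within : ℕ → Fin n → Bool
  Within zero v = v == u₀
  Within (suc k) v = Within k v ∨ (ok v ∧ any (λ w → Within k w ∧ adj H w v) (allFin n))

  within-inflate : ∀ k v → T (Within k v) → T (Within (suc k) v)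
  within-inflate k v r = from T-∨ (inj₁ r)

  within-step : ∀ k {w v} → T (Within k w) → OK v → adj H w v ≡ true → T (Within (suc k) v)
  within-step k {w} {v} r okv a =
    from T-∨ (inj₂ (from T-∧ (okv , from (T-anyFin _) (w , from T-∧ (r , from T-≡ a)))))

  within-walk : ∀ k v → T (Within k v) → Walk H OK u₀ v
  within-walk zero v r with refl ← to (T-== {i = v} {u₀}) r = here ok₀
  within-walk (suc k) v r with to T-∨ r
  ... | inj₁ r′ = within-walk k v r′
  ... | inj₂ r′ with okv , s ← to T-∧ r′ with w , t ← to (T-anyFin _) s with rw , a ← to T-∧ t =
    walk-snoc (within-walk k w rw) (to T-≡ a) okv

  stage : ℕ
  stage = proj₁ (stabilises Within within-inflate)

  Reachable : Fin n → Bool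
  Reachable = Within stage

  reachable-start : T (Reachable u₀)
  reachable-start = start stage
    where
      start : ∀ k → T (Within k u₀)
      start zero = from (T-== {i = u₀}) refl
      start (suc k) = within-inflate k u₀ (start k)

  reachable-closed : ∀ {w v} → T (Reachable w) → OK v → adj H w v ≡ true → T (Reachable v)
  reachable-closed {w} {v} r okv a =
    proj₂ (stabilises Within within-inflate) v (within-step stage r okv a)

  reachable-walk : ∀ u v → T (Reachable u) → T (Reachable v) → Walk H OK u v
  reachable-walk u v ru rv = walk-++ (walk-reverse (within-walk stage u ru)) (within-walk stage v rv)

record Split {n} (H : Graph n) : Set where
  field
    {a b} : ℕ
    G₁ : Graph a
    G₂ : Graph b
    union : UnionAtMostOneCommon H G₁ G₂
    a<n : a < n
    b<n : b < n

module Induced {n} (H : Graph n) (S : Fin n → Bool) where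

  k : ℕ
  k = length (members S)

  incl : Fin k → Fin n
  incl = List.lookup (members S)

  incl-injective : ∀ i j → incl i ≡ incl j → i ≡ j
  incl-injective = unique⇒lookup-injective (Unique.filter⁺ (T? ∘ S) (Unique.allFin⁺ n))

  incl-in : ∀ i → T (S (incl i))
  incl-in i = to (∈-members {S = S}) (∈-lookup i)

  incl-onto : ∀ {v} → T (S v) → ∃ λ i → incl i ≡ v
  incl-onto sv = index v∈ , sym (lookup-index v∈)
    where v∈ = from (∈-members {S = S}) sv

  fewer : ∀ {v} → ¬ T (S v) → k < n
  fewer {v} v∉S = subst (k <_) (length-tabulate (λ i → i))
    (⊂⇒length< (Unique.filter⁺ (T? ∘ S) (Unique.allFin⁺ n)) (λ _ → ∈-allFin _) (∈-allFin v)
               (v∉S ∘ to (∈-members {S = S})))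

  graph : Graph k
  graph = record { adj = λ i j → adj H (incl i) (incl j)
                 ; sym = λ i j → Graph.sym H (incl i) (incl j)
                 ; irrefl = λ i → irrefl H (incl i) }

split-by : ∀ {n} (H : Graph n) (S S′ : Fin n → Bool) →
  (∀ v → T (S v) ⊎ T (S′ v)) →
  (∀ v w → adj H v w ≡ true → (T (S v) × T (S w)) ⊎ (T (S′ v) × T (S′ w))) →
  (∀ v w → T (S v) → T (S′ v) → T (S w) → T (S′ w) → v ≡ w) →
  (∃ λ v → ¬ T (S v)) → (∃ λ v → ¬ T (S′ v)) → Split H
split-by H S S′ cover edge-inside shared (_ , v∉S) (_ , v∉S′) = record
  { G₁ = I.graph ; G₂ = J.graph ; a<n = I.fewer v∉S ; b<n = J.fewer v∉S′
  ; union = record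
    { e₁ = I.incl ; e₂ = J.incl ; inj₁ = I.incl-injective ; inj₂ = J.incl-injective
    ; cover = λ v → Sum.map I.incl-onto J.incl-onto (cover v)
    ; edges = λ x y → mk⇔ (inside x y) outside
    ; common = λ i j i′ j′ e e′ → I.incl-injective i i′ (shared _ _
        (I.incl-in i) (subst (T ∘ S′) (sym e) (J.incl-in j))
        (I.incl-in i′) (subst (T ∘ S′) (sym e′) (J.incl-in j′))) } }
  where
    module I = Induced H S
    module J = Induced H S′
    inside : ∀ x y → adj H x y ≡ true → _
    inside x y a with edge-inside x y a
    ... | inj₁ (sx , sy) with i , refl ← I.incl-onto sx | j , refl ← I.incl-onto sy =
      inj₁ (i , j , refl , refl , a)
    ... | inj₂ (sx , sy) with i , refl ← J.incl-onto sx | j , refl ← J.incl-onto sy =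
      inj₂ (i , j , refl , refl , a)
    outside : ∀ {x y} → _ → adj H x y ≡ true
    outside (inj₁ (i , j , refl , refl , a)) = a
    outside (inj₂ (i , j , refl , refl , a)) = a

-- Either all ok vertices are joined
-- by walks through ok vertices, or H splits into the vertices reachable from
-- u₀ (together with the non-ok vertex) and the unreachable ones.
reach-or-split : ∀ {n} (H : Graph n) (ok : Fin n → Bool) →
  (∀ v w → ¬ T (ok v) → ¬ T (ok w) → v ≡ w) → ∀ u₀ → T (ok u₀) →
  (∀ u v → T (ok u) → T (ok v) → Walk H (T ∘ ok) u v) ⊎ Split H
reach-or-split {n} H ok one-bad u₀ ok₀ = by-cases (Fin.all? (λ v → T? (ok v) →-dec T? (Reachable v)))
  where
    open Reach H ok u₀ ok₀
    S S′ : Fin n → Bool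
    S w = Reachable w ∨ not (ok w)
    S′ w = not (Reachable w)
    cover : ∀ w → T (S w) ⊎ T (S′ w)
    cover w with Reachable w
    ... | true = inj₁ tt
    ... | false = inj₂ tt
    -- the shared vertices are not ok, so there is at most one
    bad : ∀ w → T (S w) → T (S′ w) → ¬ T (ok w)
    bad w with Reachable w | ok w
    ... | false | false = λ _ _ ()
    ... | true | _ = λ _ ()
    shared : ∀ w w′ → T (S w) → T (S′ w) → T (S w′) → T (S′ w′) → w ≡ w′
    shared w w′ s s′ t t′ = one-bad w w′ (bad w s s′) (bad w′ t t′)
    -- an edge leaving the reachable set ends at the non-ok vertex
    leaves : ∀ {w w′} → T (Reachable w) → ¬ T (Reachable w′) → adj H w w′ ≡ true → T (not (ok w′))
    leaves {w′ = w′} rw ¬rw′ a with ok w′ in okw′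
    ... | false = tt
    ... | true = ¬rw′ (reachable-closed rw (subst T (sym okw′) tt) a)
    inside : ∀ w w′ → adj H w w′ ≡ true → (T (S w) × T (S w′)) ⊎ (T (S′ w) × T (S′ w′))
    inside w w′ a with Reachable w in rw | Reachable w′ in rw′
    ... | true | true = inj₁ (tt , tt)
    ... | false | false = inj₂ (tt , tt)
    ... | true | false = inj₁ (tt , leaves (subst T (sym rw) tt) (λ r → subst T rw′ r) a)
    ... | false | true =
      inj₁ (leaves (subst T (sym rw′) tt) (λ r → subst T rw r) (trans (Graph.sym H w′ w) a) , tt)
    S′-misses : ¬ T (S′ u₀)
    S′-misses with Reachable u₀ | reachable-start
    ... | true | _ = λ ()
    by-cases : Dec (∀ v → T (ok v) → T (Reachable v)) →
      (∀ u v → T (ok u) → T (ok v) → Walk H (T ∘ ok) u v) ⊎ Split H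
    by-cases (yes all-reached) = inj₁ λ u v oku okv → reachable-walk u v (all-reached u oku) (all-reached v okv)
    by-cases (no ¬all-reached) = inj₂ (split-by H S S′ cover inside shared (v , S-misses) (u₀ , S′-misses))
      where
        unreached = Fin.¬∀⟶∃¬ n _ (λ v → T? (ok v) →-dec T? (Reachable v)) ¬all-reached
        v = proj₁ unreached
        S-misses : ¬ T (S v)
        S-misses with Reachable v | ok v | T-¬⇒ (ok v) (Reachable v) (proj₂ unreached)
        ... | false | true | _ = λ ()
        ... | true | _ | _ , ¬reached = λ _ → ¬reached tt
        ... | false | false | () , _

all-or : ∀ {n} {P : Fin n → Set} {Q : Set} → (∀ x → P x ⊎ Q) → (∀ x → P x) ⊎ Q
all-or {zero} _ = inj₁ λ ()
all-or {suc n} {P} f with f zero | all-or {P = P ∘ suc} (f ∘ suc)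
... | inj₂ q | _ = inj₂ q
... | inj₁ _ | inj₂ q = inj₂ q
... | inj₁ p₀ | inj₁ ps = inj₁ λ { zero → p₀ ; (suc i) → ps i }

-- Fact (B): every graph is 2-connected, has at most one vertex, or splits.  For the
-- connectivity test all vertices are ok; for removing x all but x are.
decompose : ∀ {n} (H : Graph n) → TwoConnected H ⊎ (n ≤ 1 ⊎ Split H)
decompose {zero} H = inj₂ (inj₁ z≤n)
decompose {suc zero} H = inj₂ (inj₁ (s≤s z≤n))
decompose {suc (suc m)} H with reach-or-split H (const true) (λ _ _ bad → ⊥-elim (bad tt)) zero tt
... | inj₂ split = inj₂ (inj₂ split)
... | inj₁ joined
    with all-or (λ x → reach-or-split H (λ v → not (v == x)) (only x) (other x) (from T-≢ (other≢ x)))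
  where
    other : Fin (suc (suc m)) → Fin (suc (suc m))
    other zero = suc zero
    other (suc _) = zero
    other≢ : ∀ x → other x ≢ x
    other≢ zero ()
    other≢ (suc _) ()
    only : ∀ x v w → ¬ T (not (v == x)) → ¬ T (not (w == x)) → v ≡ w
    only x v w v-cut w-cut with v ≟ x | w ≟ x
    ... | yes refl | yes refl = refl
    ... | no _ | _ = ⊥-elim (v-cut tt)
    ... | _ | no _ = ⊥-elim (w-cut tt)
... | inj₂ split = inj₂ (inj₂ split)
... | inj₁ avoiding = inj₁ (s≤s (s≤s z≤n) , (λ u v → walk-map (const tt) (joined u v tt tt)) ,
        λ x u v u≢x v≢x → walk-map (to T-≢) (avoiding x u v (from T-≢ u≢x) (from T-≢ v≢x)))

module SplitFacts {n} {H : Graph n} (split : Split H) where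
  open Split split public

  smaller₁ : weight G₁ < weight H
  smaller₁ = Embedding.weight< {G = G₁} {K = H} e₁ e₁-injective e₁-preserves a<n
    where open Union union

  smaller₂ : weight G₂ < weight H
  smaller₂ = Embedding.weight< {G = G₂} {K = H} e₁ e₁-injective e₁-preserves b<n
    where open Union (Union.swap union)

  no-copy : ∀ {k} (K : Graph k) → k < n → copies H K ≡ 0
  no-copy K k<n with copies-zero-or-embedding H K
  ... | inj₁ none = none
  ... | inj₂ (f , emb) = contradiction (<-≤-trans k<n (VecEmbedding.vertices≤ emb)) (<-irrefl refl)

-- Graphs with at most one vertex or with a split are not 2-connected: for a
-- split, additivity would give 1 = H(H) = H(G₁) + H(G₂) = 0.
not-2-connected : ∀ {n} (H : Graph n) → n ≤ 1 ⊎ Split H → ¬ TwoConnected H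
not-2-connected H (inj₁ n≤1) tc = contradiction (<-≤-trans (proj₁ tc) n≤1) (<-irrefl refl)
not-2-connected H (inj₂ split) tc = contradiction one≡zero λ ()
  where
    open SplitFacts split
    one≡zero : 1 ≡ 0
    one≡zero = begin
      1                           ≡⟨ sym (copies-self H) ⟩
      copies H H                  ≡⟨ Additivity.copies-additive tc union ⟩
      copies H G₁ ℕ.+ copies H G₂ ≡⟨ cong₂ ℕ._+_ (no-copy G₁ a<n) (no-copy G₂ b<n) ⟩
      0                           ∎
      where open ≡-Reasoning

two-connected? : ∀ {n} (H : Graph n) → TwoConnected H ⊎ ¬ TwoConnected H
two-connected? H with decompose H
... | inj₁ tc = inj₁ tc
... | inj₂ degenerate = inj₂ (not-2-connected H degenerate)

self-union : ∀ {n} (H : Graph n) → n ≤ 1 → UnionAtMostOneCommon H H H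
self-union H n≤1 = record
  { e₁ = λ i → i ; e₂ = λ i → i ; inj₁ = λ _ _ e → e ; inj₂ = λ _ _ e → e
  ; cover = λ x → inj₁ (x , refl)
  ; edges = λ x y → mk⇔ (λ a → inj₁ (x , y , refl , refl , a))
                        (λ { (inj₁ (_ , _ , refl , refl , a)) → a ; (inj₂ (_ , _ , refl , refl , a)) → a })
  ; common = λ i j i′ j′ _ _ → at-most-one n≤1 i i′ }
  where
    at-most-one : ∀ {n} → n ≤ 1 → (i j : Fin n) → i ≡ j
    at-most-one (s≤s z≤n) zero zero = refl

-- Linear combinations Σ_t c_t X(t) of counts X : Term → ℕ over a ring.
-- The graph function p is eval L, and eval L K = combine L (count K).
module Combination {c ℓ} (R : CommutativeRing c ℓ) where
  open CommutativeRing R hiding (zero) renaming (refl to ≈-refl; sym to ≈-sym; trans to ≈-trans)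
  open Poly R
  open import Relation.Binary.Reasoning.Setoid setoid
  open import Algebra.Properties.Group +-group using (∙-cancelʳ)
  open import Algebra.Properties.CommutativeSemigroup +-commutativeSemigroup using (interchange; x∙yz≈y∙xz)

  term : (Term → ℕ) → Term → Carrier
  term X t = coeff t * fromℕ (X t)

  combine : List Term → (Term → ℕ) → Carrier
  combine L X = List.foldr (λ t acc → term X t + acc) 0# L

  count : ∀ {k} → Graph k → Term → ℕ
  count K t = copies (graph t) K

  Vanishes : Term → Set ℓ
  Vanishes t = ¬ TwoConnected (graph t) → coeff t ≈ 0#

  fromℕ-+ : ∀ m n → fromℕ (m ℕ.+ n) ≈ fromℕ m + fromℕ n
  fromℕ-+ zero n = ≈-sym (+-identityˡ _)
  fromℕ-+ (suc m) n = ≈-trans (+-congˡ (fromℕ-+ m n)) (≈-sym (+-assoc _ _ _))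

  combine-+ : ∀ L X Y → combine L X + combine L Y ≈ combine L (λ t → X t ℕ.+ Y t)
  combine-+ [] X Y = +-identityˡ 0#
  combine-+ (t ∷ L) X Y = begin
    (term X t + combine L X) + (term Y t + combine L Y)
      ≈⟨ interchange _ _ _ _ ⟩
    (term X t + term Y t) + (combine L X + combine L Y)
      ≈⟨ +-cong (≈-sym split-term) (combine-+ L X Y) ⟩
    term (λ s → X s ℕ.+ Y s) t + combine L (λ s → X s ℕ.+ Y s) ∎
    where
      split-term : coeff t * fromℕ (X t ℕ.+ Y t) ≈ term X t + term Y t
      split-term = ≈-trans (*-congˡ (fromℕ-+ (X t) (Y t))) (distribˡ _ _ _)

  Agree : (Term → ℕ) → (Term → ℕ) → Term → Set ℓ
  Agree X Y t = X t ≡ Y t ⊎ coeff t ≈ 0#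

  term-agree : ∀ {X Y t} → Agree X Y t → term X t ≈ term Y t
  term-agree {X} {Y} {t} (inj₁ same) rewrite same = ≈-refl
  term-agree {X} {Y} {t} (inj₂ c≈0) = ≈-trans (vanish X) (≈-sym (vanish Y))
    where
      vanish : ∀ Z → term Z t ≈ 0#
      vanish Z = ≈-trans (*-congʳ c≈0) (zeroˡ _)

  combine-agree : ∀ L {X Y} → All (Agree X Y) L → combine L X ≈ combine L Y
  combine-agree [] [] = ≈-refl
  combine-agree (t ∷ L) {X} {Y} (a ∷ as) = +-cong (term-agree {X} {Y} a) (combine-agree L as)

  combine-─ : ∀ L {t} (p : t ∈ L) X → combine L X ≈ term X t + combine (L ─ p) X
  combine-─ (s ∷ L) (here refl) X = ≈-refl
  combine-─ (s ∷ L) (there p) X = ≈-trans (+-congˡ (combine-─ L p X)) (x∙yz≈y∙xz _ _ _)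

  isolate : ∀ L {t} (p : t ∈ L) X Y → combine L X ≈ combine L Y → All (Agree X Y) (L ─ p) →
    term X t ≈ term Y t
  isolate L {t} p X Y same others = ∙-cancelʳ _ _ _ (begin
    term X t + combine (L ─ p) X ≈⟨ ≈-sym (combine-─ L p X) ⟩
    combine L X                 ≈⟨ same ⟩
    combine L Y                 ≈⟨ combine-─ L p Y ⟩
    term Y t + combine (L ─ p) Y ≈⟨ +-congˡ (≈-sym (combine-agree (L ─ p) others)) ⟩
    term Y t + combine (L ─ p) X ∎)

  vanish-0 : ∀ x → x * fromℕ 1 ≈ x * fromℕ 0 → x ≈ 0#
  vanish-0 x e = begin
    x            ≈⟨ ≈-sym (*-identityʳ x) ⟩
    x * 1#       ≈⟨ *-congˡ (≈-sym (+-identityʳ 1#)) ⟩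
    x * fromℕ 1  ≈⟨ e ⟩
    x * 0#       ≈⟨ zeroʳ x ⟩
    0#           ∎

  vanish-2 : ∀ x → x * fromℕ 1 ≈ x * fromℕ 2 → x ≈ 0#
  vanish-2 x e = ≈-sym (∙-cancelʳ x 0# x (begin
    0# + x                  ≈⟨ +-identityˡ x ⟩
    x                       ≈⟨ ≈-sym x·1 ⟩
    x * fromℕ 1             ≈⟨ e ⟩
    x * (1# + fromℕ 1)      ≈⟨ distribˡ x 1# (fromℕ 1) ⟩
    x * 1# + x * fromℕ 1    ≈⟨ +-cong (*-identityʳ x) x·1 ⟩
    x + x                   ∎))
    where
      x·1 : x * fromℕ 1 ≈ x
      x·1 = ≈-trans (*-congˡ (+-identityʳ 1#)) (*-identityʳ x)

  -- The easy direction: only 2-connected graphs, whose counts are additive, survive.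
  additive-if-2-connected : ∀ L → All Vanishes L → TwoAdditive L
  additive-if-2-connected L vanishing G G₁ G₂ u =
    ≈-trans (combine-agree L (All.map agree vanishing)) (≈-sym (combine-+ L (count G₁) (count G₂)))
    where
      agree : ∀ {t} → Vanishes t → Agree (count G) (λ s → count G₁ s ℕ.+ count G₂ s) t
      agree {t} vanishes with two-connected? (graph t)
      ... | inj₁ tc = inj₁ (Additivity.copies-additive tc u)
      ... | inj₂ ntc = inj₂ (vanishes ntc)

  others-distinct : ∀ L → AllPairs (λ s t → ¬ Iso (graph s) (graph t)) L →
    ∀ {t} (p : t ∈ L) → All (λ s → ¬ Iso (graph s) (graph t)) (L ─ p)
  others-distinct (s ∷ L) (s≇ ∷ _) (here refl) = All.map (λ s≇t iso → s≇t (Iso-sym iso)) s≇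
  others-distinct (s ∷ L) (s≇ ∷ distinct) (there p) = All.lookup s≇ p ∷ others-distinct L distinct p

  module Forward (L : List Term) (distinct : AllPairs (λ s t → ¬ Iso (graph s) (graph t)) L)
                 (additive : TwoAdditive L) where

    isolate-union : ∀ {t} (p : t ∈ L) →
      (∀ {s} → s ∈ L → weight (graph s) < weight (graph t) → Vanishes s) →
      ∀ {a b} {G₁ : Graph a} {G₂ : Graph b} → UnionAtMostOneCommon (graph t) G₁ G₂ →
      NoLargeCopies (graph t) G₁ → NoLargeCopies (graph t) G₂ →
      coeff t * fromℕ 1 ≈ coeff t * fromℕ (count G₁ t ℕ.+ count G₂ t)
    isolate-union {t} p smaller-vanish {G₁ = G₁} {G₂} u none₁ none₂ =
      subst (λ k → coeff t * fromℕ k ≈ coeff t * fromℕ (count G₁ t ℕ.+ count G₂ t)) (copies-self H)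
        (isolate L p (count H) (λ s → count G₁ s ℕ.+ count G₂ s)
          (≈-trans (additive H G₁ G₂ u) (combine-+ L (count G₁) (count G₂)))
          (All.zipWith agree (─⁺ p (All.tabulate smaller-vanish) , others-distinct L distinct p)))
      where
        H = graph t
        -- every other term agrees: 2-connected ones by additivity, lighter ones
        -- vanish, and heavier ones have no copies in H, G₁ or G₂
        agree : ∀ {s} → (weight (graph s) < weight H → Vanishes s) × ¬ Iso (graph s) H →
          Agree (count H) (λ s → count G₁ s ℕ.+ count G₂ s) s
        agree {s} (vanishes , s≇H) with two-connected? (graph s) | weight (graph s) <? weight H
        ... | inj₁ tc | _ = inj₁ (Additivity.copies-additive tc u)
        ... | inj₂ ntc | yes lighter = inj₂ (vanishes lighter ntc)
        ... | inj₂ _ | no ¬lighter = inj₁ (trans (no-large-copies-self H F s≇H heavier)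
                                           (sym (cong₂ ℕ._+_ (none₁ F s≇H heavier) (none₂ F s≇H heavier))))
          where
            F = graph s
            heavier = ≮⇒≥ ¬lighter

    vanishing : All Vanishes L
    vanishing = All.tabulate (λ p → <-rec Claim induction-step _ p refl)
      where
        Claim : ℕ → Set _
        Claim k = ∀ {t} → t ∈ L → weight (graph t) ≡ k → Vanishes t
        induction-step : ∀ k → (∀ {j} → j < k → Claim j) → Claim k
        induction-step _ ih {t} p refl ntc = by-decomposition (decompose H)
          where
            H = graph t
            lighter : ∀ {s} → s ∈ L → weight (graph s) < weight H → Vanishes s
            lighter s∈ lt = ih lt s∈ refl
            by-decomposition : TwoConnected H ⊎ (size t ≤ 1 ⊎ Split H) → coeff t ≈ 0#
            by-decomposition (inj₁ tc) = contradiction tc ntc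
            -- H = H ∪ H gives c·H(H) = 2c·H(H)
            by-decomposition (inj₂ (inj₁ trivial)) = vanish-2 (coeff t)
              (subst (λ k → coeff t * fromℕ 1 ≈ coeff t * fromℕ (k ℕ.+ k)) (copies-self H)
                 (isolate-union p lighter (self-union H trivial) (no-large-copies-self H) (no-large-copies-self H)))
            -- H = G₁ ∪ G₂ with lighter pieces gives c·H(H) = 0
            by-decomposition (inj₂ (inj₂ split)) = vanish-0 (coeff t)
              (subst (λ k → coeff t * fromℕ 1 ≈ coeff t * fromℕ k)
                     (cong₂ ℕ._+_ (no-copy G₁ a<n) (no-copy G₂ b<n))
                 (isolate-union p lighter union (no-large-copies-smaller H G₁ smaller₁)
                                                (no-large-copies-smaller H G₂ smaller₂)))
              where open SplitFacts split

lemma6p4 : ∀ {c ℓ : Level} (R : CommutativeRing c ℓ) (L : List (Poly.Term R)) →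
    AllPairs (λ s t → ¬ Iso (Poly.graph R s) (Poly.graph R t)) L →
    Poly.TwoAdditive R L ⇔
      All (λ t → ¬ TwoConnected (Poly.graph R t) → CommutativeRing._≈_ R (Poly.coeff R t) (CommutativeRing.0# R)) L
lemma6p4 R L distinct = mk⇔ (λ additive → Forward.vanishing L distinct (λ {n} {a} {b} → additive {n} {a} {b}))
                             (λ vanishing {n} {a} {b} → additive-if-2-connected L vanishing {n} {a} {b})
  where open Combination R
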